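{- Let $\Gamma\le S_m$ and let $a_1,\dots,a_m\ge2$ be integers. If the commutator subgroup $[\Gamma,\Gamma]$ acts transitively on $[m]$, then \[R_\Gamma(a_1,a_2,\dots,a_m)=\min\{a_i: 1\le i\le m\}.\]
   Context: An $m$-edge-coloured complete graph is a complete graph with each edge coloured from $[m]=\{1,\dots,m\}$. For $\Gamma\le S_m$, $\pi\in\Gamma$ and a vertex $v$, switching at $v$ with $\pi$ recolours every edge incident with $v$ of colour $i$ to colour $\pi(i)$, leaving other edges unchanged. Two such graphs on the same vertex set are $\Gamma$-switch equivalent if one is obtained from the other by a finite sequence of switches. $K_t^{(i)}$ is a complete graph on $t$ vertices with all edges of colour $i$. $R_\Gamma(a_1,\dots,a_m)$ is the least $n$ such that every $m$-edge-coloured complete graph on $n$ vertices is $\Gamma$-switch equivalent to one containing, for some $i$, a copy of $K_{a_i}^{(i)}$. -}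

module Defs where

open import Level using (0ℓ)
open import Data.Nat using (ℕ; _≤_; _<_)
open import Data.Fin using (Fin)
open import Data.Fin.Permutation using (Permutation′; _⟨$⟩ʳ_; _∘ₚ_; flip; id; _≈_)
open import Data.Product using (Σ; ∃; _×_; _,_)
open import Data.Bool using (Bool; true; false; _xor_)
open import Relation.Nullary using (¬_; does)
open import Relation.Binary.PropositionalEquality using (_≡_; _≢_)
open import Relation.Binary.Construct.Closure.ReflexiveTransitive using (Star)
open import Function.Definitions using (Injective)
import Data.Fin as F

record IsSubgroup (m : ℕ) (Γ : Permutation′ m → Set) : Set where
  field
    resp  : ∀ {π ρ} → π ≈ ρ → Γ π → Γ ρ
    has-id : Γ id
    ∘-closed : ∀ {π ρ} → Γ π → Γ ρ → Γ (π ∘ₚ ρ)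
    inv-closed : ∀ {π} → Γ π → Γ (flip π)

commutator : ∀ {m} → Permutation′ m → Permutation′ m → Permutation′ m
commutator π ρ = flip π ∘ₚ (flip ρ ∘ₚ (π ∘ₚ ρ))

data Commutator {m : ℕ} (Γ : Permutation′ m → Set) : Permutation′ m → Set where
  gen  : ∀ {π ρ} → Γ π → Γ ρ → Commutator Γ (commutator π ρ)
  one  : Commutator Γ id
  comp : ∀ {π ρ} → Commutator Γ π → Commutator Γ ρ → Commutator Γ (π ∘ₚ ρ)
  inv  : ∀ {π} → Commutator Γ π → Commutator Γ (flip π)
  resp : ∀ {π ρ} → π ≈ ρ → Commutator Γ π → Commutator Γ ρ

Transitive : ∀ {m} → (Permutation′ m → Set) → Set
Transitive {m} H = ∀ (i j : Fin m) → Σ (Permutation′ m) λ π → H π × (π ⟨$⟩ʳ i ≡ j)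

-- An m-edge-coloured complete graph on vertex set Fin n: a symmetric
-- colouring of pairs; the value on the diagonal is irrelevant.
record Colouring (m n : ℕ) : Set where
  field
    col : Fin n → Fin n → Fin m
    sym : ∀ u v → col u v ≡ col v u
open Colouring public

_is_ : ∀ {n} → Fin n → Fin n → Bool
u is v = does (u F.≟ v)

switchCol : ∀ {m n} → Fin n → Permutation′ m → Colouring m n → Fin n → Fin n → Fin m
switchCol v π c x y with (x is v) xor (y is v)
... | true  = π ⟨$⟩ʳ col c x y
... | false = col c x y

SwitchStep : ∀ {m n} → (Permutation′ m → Set) → Colouring m n → Colouring m n → Set
SwitchStep {m} {n} Γ c d =
  Σ (Fin n) λ v → Σ (Permutation′ m) λ π → Γ π × (∀ x y → col d x y ≡ switchCol v π c x y)

SwitchEquiv : ∀ {m n} → (Permutation′ m → Set) → Colouring m n → Colouring m n → Set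
SwitchEquiv Γ = Star (SwitchStep Γ)

ContainsMono : ∀ {m n} → Colouring m n → ℕ → Fin m → Set
ContainsMono {m} {n} c t i =
  Σ (Fin t → Fin n) λ f → Injective _≡_ _≡_ f × (∀ x y → x ≢ y → col c (f x) (f y) ≡ i)

RamseyProp : ∀ {m} → (Permutation′ m → Set) → (Fin m → ℕ) → ℕ → Set
RamseyProp {m} Γ a n = ∀ (c : Colouring m n) →
  Σ (Colouring m n) λ d → SwitchEquiv Γ c d × Σ (Fin m) λ i → ContainsMono d (a i) i

IsRamseyNumber : ∀ {m} → (Permutation′ m → Set) → (Fin m → ℕ) → ℕ → Set
IsRamseyNumber Γ a r = RamseyProp Γ a r × (∀ n → n < r → ¬ RamseyProp Γ a n)

IsMinimum : ∀ {m} → (Fin m → ℕ) → ℕ → Set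
IsMinimum {m} a μ = Σ (Fin m) (λ i → a i ≡ μ) × (∀ i → μ ≤ a i)

-- Switching at v by π⁻¹, at u by ρ⁻¹, at v by π and at u by ρ recolours
-- the edge uv by the commutator of π and ρ and leaves every other edge
-- unchanged: an edge meeting exactly one of u, v is hit by the switches at
-- that vertex only, and these cancel.  Hence every element of [Γ,Γ] can be
-- applied to a single edge, and since [Γ,Γ] is transitive, the edges can be
-- recoloured one by one to a fixed colour i.  Every colouring on a_i
-- vertices is thus switch equivalent to K_{a_i}^{(i)}, whereas on fewer
-- than min a_i vertices there is no room for any K_{a_j}.
module Submission where

open import Defs hiding (sym)
open import Data.Nat using (ℕ; _≤_; _<_)
open import Data.Nat.Properties using (<-≤-trans)
open import Data.Fin using (Fin; _≟_)
open import Data.Fin.Properties using (<⇒notInjective)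
open import Data.Fin.Permutation using (Permutation′; _⟨$⟩ʳ_; _⟨$⟩ˡ_; flip; id; inverseˡ; inverseʳ)
open import Data.Bool using (Bool; true; false; _xor_; _∧_; if_then_else_)
open import Data.Bool.Properties using (xor-comm)
open import Data.Product using (Σ; _×_; _,_; proj₁)
open import Data.Sum using (_⊎_; inj₁; inj₂)
open import Data.List using (List; []; _∷_; allFin; cartesianProduct)
open import Data.List.Membership.Propositional using (_∈_)
open import Data.List.Membership.Propositional.Properties using (∈-cartesianProduct⁺; ∈-allFin)
open import Data.List.Relation.Unary.Any using (here; there)
open import Relation.Nullary using (¬_; yes; no; contradiction)
open import Relation.Binary.PropositionalEquality using (_≡_; _≢_; refl; sym; trans; cong; cong₂; subst)
open import Relation.Binary.Construct.Closure.ReflexiveTransitive using (ε; _◅_; _◅◅_)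
import Function

when : ∀ {A : Set} → Bool → (A → A) → A → A
when b f = if b then f else Function.id

when-id : ∀ {A : Set} b (k : A) → when b Function.id k ≡ k
when-id true  k = refl
when-id false k = refl

when-cong : ∀ {A : Set} b {f g : A → A} → (∀ k → f k ≡ g k) → ∀ k → when b f k ≡ when b g k
when-cong true  f≗g k = f≗g k
when-cong false f≗g k = refl

when-commutator : ∀ {m} (π ρ : Permutation′ m) A B k →
  when B (ρ ⟨$⟩ʳ_) (when A (π ⟨$⟩ʳ_) (when B (ρ ⟨$⟩ˡ_) (when A (π ⟨$⟩ˡ_) k)))
    ≡ when (A ∧ B) (commutator π ρ ⟨$⟩ʳ_) k
when-commutator π ρ true  true  k = refl
when-commutator π ρ true  false k = inverseʳ π
when-commutator π ρ false true  k = inverseʳ ρ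
when-commutator π ρ false false k = refl

⟨$⟩ˡ-cong : ∀ {m} (π ρ : Permutation′ m) → (∀ k → π ⟨$⟩ʳ k ≡ ρ ⟨$⟩ʳ k) → ∀ k → π ⟨$⟩ˡ k ≡ ρ ⟨$⟩ˡ k
⟨$⟩ˡ-cong π ρ π≗ρ k = trans (sym (inverseˡ ρ)) (cong (ρ ⟨$⟩ˡ_) (trans (sym (π≗ρ _)) (inverseʳ π)))

module _ {n : ℕ} where

  incident : Fin n → Fin n → Fin n → Bool
  incident v x y = (x is v) xor (y is v)

  isEdge : Fin n → Fin n → Fin n → Fin n → Bool
  isEdge u v x y = incident v x y ∧ incident u x y

  incident-sym : ∀ v x y → incident v x y ≡ incident v y x
  incident-sym v x y = xor-comm (x is v) (y is v)

  isEdge-sym : ∀ u v x y → isEdge u v x y ≡ isEdge u v y x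
  isEdge-sym u v x y = cong₂ _∧_ (incident-sym v x y) (incident-sym u x y)

  isEdge-self : ∀ {u v} → u ≢ v → isEdge u v u v ≡ true
  isEdge-self {u} {v} u≢v with u ≟ v | v ≟ v | u ≟ u | v ≟ u
  ... | yes u≡v | _        | _        | _       = contradiction u≡v u≢v
  ... | _       | no v≢v   | _        | _       = contradiction refl v≢v
  ... | _       | _        | no u≢u   | _       = contradiction refl u≢u
  ... | _       | _        | _        | yes v≡u = contradiction (sym v≡u) u≢v
  ... | no _    | yes _    | yes _    | no _    = refl

  isEdge-endpoints : ∀ {u v} → u ≢ v → ∀ x y → isEdge u v x y ≡ true →
                     (x ≡ u × y ≡ v) ⊎ (x ≡ v × y ≡ u)
  isEdge-endpoints {u} {v} u≢v x y _ with x ≟ v | y ≟ v | x ≟ u | y ≟ u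
  isEdge-endpoints u≢v x y () | yes _    | yes _    | _        | _
  isEdge-endpoints u≢v x y _  | yes refl | no _     | yes refl | _        = contradiction refl u≢v
  isEdge-endpoints u≢v x y _  | yes refl | no _     | no _     | yes refl = inj₂ (refl , refl)
  isEdge-endpoints u≢v x y () | yes _    | no _     | no _     | no _
  isEdge-endpoints u≢v x y _  | no _     | yes refl | yes refl | no _     = inj₁ (refl , refl)
  isEdge-endpoints u≢v x y () | no _     | yes _    | yes _    | yes _
  isEdge-endpoints u≢v x y _  | no _     | yes refl | no _     | yes refl = contradiction refl u≢v
  isEdge-endpoints u≢v x y () | no _     | yes _    | no _     | no _
  isEdge-endpoints u≢v x y () | no _     | no _     | _        | _

module _ {m n : ℕ} where

  _≐_ : Colouring m n → Colouring m n → Set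
  c ≐ d = ∀ x y → col c x y ≡ col d x y

  switch : Fin n → Permutation′ m → Colouring m n → Colouring m n
  switch v π c = record
    { col = λ x y → when (incident v x y) (π ⟨$⟩ʳ_) (col c x y)
    ; sym = λ x y → cong₂ (λ b → when b (π ⟨$⟩ʳ_)) (incident-sym v x y) (Colouring.sym c x y)
    }

  switchCol≡switch : ∀ v π c x y → switchCol v π c x y ≡ col (switch v π c) x y
  switchCol≡switch v π c x y with incident v x y
  ... | true  = refl
  ... | false = refl

  recolour : Fin n → Fin n → (Fin m → Fin m) → Colouring m n → Colouring m n
  recolour u v f c = record
    { col = λ x y → when (isEdge u v x y) f (col c x y)
    ; sym = λ x y → cong₂ (λ b → when b f) (isEdge-sym u v x y) (Colouring.sym c x y)
    }

  recolour-edge : ∀ {u v} → u ≢ v → ∀ f c x y → isEdge u v x y ≡ true →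
                  col (recolour u v f c) x y ≡ f (col c u v)
  recolour-edge u≢v f c x y e rewrite e with isEdge-endpoints u≢v x y e
  ... | inj₁ (refl , refl) = refl
  ... | inj₂ (refl , refl) = cong f (Colouring.sym c _ _)

  recolour-elsewhere : ∀ u v f c x y → isEdge u v x y ≡ false → col (recolour u v f c) x y ≡ col c x y
  recolour-elsewhere u v f c x y e rewrite e = refl

module _ {m : ℕ} (Γ : Permutation′ m → Set) (Γ-subgroup : IsSubgroup m Γ) where
  open IsSubgroup Γ-subgroup

  module _ {n : ℕ} where

    switch-step : ∀ v {π} → Γ π → (c : Colouring m n) → SwitchStep Γ c (switch v π c)
    switch-step v {π} π∈Γ c = v , π , π∈Γ , λ x y → sym (switchCol≡switch v π c x y)

    Recolourable : Fin n → Fin n → (Fin m → Fin m) → Set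
    Recolourable u v f = ∀ c d → d ≐ recolour u v f c → SwitchEquiv Γ c d

    recolourable-cong : ∀ {u v f g} → (∀ k → f k ≡ g k) → Recolourable u v f → Recolourable u v g
    recolourable-cong {u} {v} f≗g rec-f c d d≐g =
      rec-f c d λ x y → trans (d≐g x y) (sym (when-cong (isEdge u v x y) f≗g (col c x y)))

    recolourable-id : ∀ u v → Recolourable u v Function.id
    recolourable-id u v c d d≐c = (v , id , has-id , d≐switch) ◅ ε
      where
      d≐switch : ∀ x y → col d x y ≡ switchCol v id c x y
      d≐switch x y = trans (d≐c x y) (trans (when-id (isEdge u v x y) (col c x y))
        (trans (sym (when-id (incident v x y) (col c x y))) (sym (switchCol≡switch v id c x y))))

    recolourable-∘ : ∀ {u v f g} → Recolourable u v f → Recolourable u v g → Recolourable u v (g Function.∘ f)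
    recolourable-∘ {u} {v} {f} {g} rec-f rec-g c d d≐gf =
      rec-f c (recolour u v f c) (λ _ _ → refl) ◅◅ rec-g (recolour u v f c) d (λ x y → trans (d≐gf x y) (split x y))
      where
      split : ∀ x y → col (recolour u v (g Function.∘ f) c) x y ≡ col (recolour u v g (recolour u v f c)) x y
      split x y with isEdge u v x y
      ... | true  = refl
      ... | false = refl

    recolourable-commutator : ∀ u v {π ρ} → Γ π → Γ ρ → Recolourable u v (commutator π ρ ⟨$⟩ʳ_)
    recolourable-commutator u v {π} {ρ} π∈Γ ρ∈Γ c d d≐σc =
      switch-step v (inv-closed π∈Γ) c ◅
      switch-step u (inv-closed ρ∈Γ) c₁ ◅
      switch-step v π∈Γ c₂ ◅
      (u , ρ , ρ∈Γ , d≐switch) ◅ ε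
      where
      c₁ = switch v (flip π) c
      c₂ = switch u (flip ρ) c₁
      c₃ = switch v π c₂
      d≐switch : ∀ x y → col d x y ≡ switchCol u ρ c₃ x y
      d≐switch x y = trans (d≐σc x y)
        (trans (sym (when-commutator π ρ (incident v x y) (incident u x y) (col c x y)))
               (sym (switchCol≡switch u ρ c₃ x y)))

    recolourable-commutatorSubgroup : ∀ u v {σ} → Commutator Γ σ →
      Recolourable u v (σ ⟨$⟩ʳ_) × Recolourable u v (flip σ ⟨$⟩ʳ_)
    recolourable-commutatorSubgroup u v (gen π∈Γ ρ∈Γ) =
      recolourable-commutator u v π∈Γ ρ∈Γ , recolourable-commutator u v ρ∈Γ π∈Γ
    recolourable-commutatorSubgroup u v one = recolourable-id u v , recolourable-id u v
    recolourable-commutatorSubgroup u v (comp π∈Γ′ ρ∈Γ′)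
      with recolourable-commutatorSubgroup u v π∈Γ′ | recolourable-commutatorSubgroup u v ρ∈Γ′
    ... | rec-π , rec-π⁻¹ | rec-ρ , rec-ρ⁻¹ = recolourable-∘ rec-π rec-ρ , recolourable-∘ rec-ρ⁻¹ rec-π⁻¹
    recolourable-commutatorSubgroup u v (inv π∈Γ′) with recolourable-commutatorSubgroup u v π∈Γ′
    ... | rec-π , rec-π⁻¹ = rec-π⁻¹ , rec-π
    recolourable-commutatorSubgroup u v (resp {π} {ρ} π≈ρ π∈Γ′) with recolourable-commutatorSubgroup u v π∈Γ′
    ... | rec-π , rec-π⁻¹ = recolourable-cong π≈ρ rec-π , recolourable-cong (⟨$⟩ˡ-cong π ρ π≈ρ) rec-π⁻¹

    module _ (transitive : Transitive (Commutator Γ)) (i : Fin m) where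

      monochromatise-pairs : (L : List (Fin n × Fin n)) (c : Colouring m n) →
        Σ (Colouring m n) λ d → SwitchEquiv Γ c d × (∀ {x y} → (x , y) ∈ L → x ≢ y → col d x y ≡ i)
      monochromatise-pairs [] c = c , ε , λ ()
      monochromatise-pairs ((u , v) ∷ L) c with monochromatise-pairs L c
      ... | d , c~d , d-mono with u ≟ v
      ...   | yes u≡v = d , c~d , λ { (here refl) u≢v → contradiction u≡v u≢v ; (there p) → d-mono p }
      ...   | no u≢v with transitive (col d u v) i
      ...     | σ , σ∈Γ′ , σuv≡i = recolour u v (σ ⟨$⟩ʳ_) d , c~d ◅◅ d~e , e-mono
        where
        d~e : SwitchEquiv Γ d (recolour u v (σ ⟨$⟩ʳ_) d)
        d~e = proj₁ (recolourable-commutatorSubgroup u v σ∈Γ′) d _ (λ _ _ → refl)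
        e-mono : ∀ {x y} → (x , y) ∈ ((u , v) ∷ L) → x ≢ y → col (recolour u v (σ ⟨$⟩ʳ_) d) x y ≡ i
        e-mono (here refl) _ = trans (recolour-edge u≢v _ d u v (isEdge-self u≢v)) σuv≡i
        e-mono {x} {y} (there p) x≢y = by-cases (isEdge u v x y) refl
          where
          by-cases : ∀ b → isEdge u v x y ≡ b → col (recolour u v (σ ⟨$⟩ʳ_) d) x y ≡ i
          by-cases true  e = trans (recolour-edge u≢v _ d x y e) σuv≡i
          by-cases false e = trans (recolour-elsewhere u v _ d x y e) (d-mono p x≢y)

      switchEquiv-monochromatic : (c : Colouring m n) →
        Σ (Colouring m n) λ d → SwitchEquiv Γ c d × (∀ x y → x ≢ y → col d x y ≡ i)
      switchEquiv-monochromatic c with monochromatise-pairs (cartesianProduct (allFin n) (allFin n)) c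
      ... | d , c~d , d-mono = d , c~d , λ x y → d-mono (∈-cartesianProduct⁺ (∈-allFin x) (∈-allFin y))

  ramseyProp-at : (a : Fin m → ℕ) → Transitive (Commutator Γ) → ∀ i → RamseyProp Γ a (a i)
  ramseyProp-at a transitive i c with switchEquiv-monochromatic transitive i c
  ... | d , c~d , d-mono = d , c~d , i , Function.id , Function.id , d-mono

monochromatic : ∀ {m n} → Fin m → Colouring m n
monochromatic i = record { col = λ _ _ → i ; sym = λ _ _ → refl }

¬ramseyProp-below : ∀ {m} (Γ : Permutation′ m → Set) (a : Fin m → ℕ) {n} →
                    Fin m → (∀ i → n < a i) → ¬ RamseyProp Γ a n
¬ramseyProp-below Γ a i₀ n<a ramsey with ramsey (monochromatic i₀)
... | _ , _ , i , f , f-injective , _ = <⇒notInjective (n<a i) f-injective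

corollary8 : ∀ (m : ℕ) (Γ : Permutation′ m → Set) → IsSubgroup m Γ →
    (a : Fin m → ℕ) → (∀ i → 2 ≤ a i) →
    Transitive (Commutator Γ) →
    ∀ μ → IsMinimum a μ → IsRamseyNumber Γ a μ
corollary8 m Γ Γ-subgroup a _ transitive μ ((i₀ , aᵢ₀≡μ) , μ≤a) =
  subst (RamseyProp Γ a) aᵢ₀≡μ (ramseyProp-at Γ Γ-subgroup a transitive i₀) ,
  λ n n<μ → ¬ramseyProp-below Γ a i₀ (λ i → <-≤-trans n<μ (μ≤a i))
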